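{- Let $t\ge 1$ and $m\ge 2$ be integers. The derived graph $(T_{4t+2};m)$ of the voltage tree $T_{4t+2}$ over $\mathbb{Z}_m$ has girth $4t+2$.
   Context: Voltage graphs and derived graphs: a voltage graph over $\mathbb{Z}_m$ is a finite directed multigraph with arc labels in $\mathbb{Z}_m$ (unlabelled edges have label $0$), some degree-$1$ vertices being designated pinned. In the derived graph each non-pinned vertex $v$ gives $v^0,\dots,v^{m-1}$, each pinned vertex $v^{*}$ gives one vertex $v^{*}$; an arc $v\to w$ labelled $a$ between non-pinned vertices gives edges $v^iw^{i+a}$ (indices mod $m$); an edge $v^{*}w$ with $v^{*}$ pinned gives edges $v^{*}w^i$ for all $i$. The tree $X_t$: take a pinned vertex $x^{*}$ adjacent to a vertex $x$, and a complete binary tree rooted at $x$ whose vertices are $x_b$ for bit strings $b$ of length $0\le|b|\le 2t-1$ ($x_\emptyset=x$, children of $x_b$ are $x_{b0},x_{b1}$). Let $a=0^{t-1}$ (the string of $t-1$ zeros) and delete the vertex $x_{0^{t}}$ together with all its descendants. So $x_a$ is at distance $t$ from $x^{*}$ and has degree $2$ in $X_t$; the remaining leaves have bit strings of length $2t-1$. $Y_t$ is an identical copy with $x$ replaced by $y$. $T_{4t+2}$ is obtained from $X_t$ and $Y_t$ by adding the edge $x_ay_a$; all edges of $T_{4t+2}$ have label $0$, and $x^{*},y^{*}$ are the pinned vertices. -}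

module Defs where

open import Data.Nat using (ℕ; zero; suc; _+_; _*_; _∸_; _≤_; _<ᵇ_)
open import Data.Empty using (⊥)
open import Data.Bool using (Bool; true; false; not; _∧_; T)
open import Data.List using (List; []; _∷_; _++_; [_]; length; replicate)
open import Data.Fin using (Fin; toℕ; inject₁; fromℕ)
import Data.Fin as Fin
open import Data.Product using (Σ; _×_; ∃)
open import Data.Sum using (_⊎_)
open import Relation.Binary.PropositionalEquality using (_≡_)
open import Function.Definitions using (Injective)

Cong : ℕ → ℕ → ℕ → Set
Cong m x y = ∃ λ k → (x ≡ y + k * m) ⊎ (y ≡ x + k * m)

-- Voltage graphs over ℤ_m.  Labels are natural numbers read modulo m.
-- A vertex is pinned iff `pinned v = true`.

record VoltageGraph : Set₁ where
  field
    V      : Set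
    pinned : V → Bool
    Arc    : Set
    src    : Arc → V
    tgt    : Arc → V
    label  : Arc → ℕ

module _ (m : ℕ) (G : VoltageGraph) where
  open VoltageGraph G

  data DVert : Set where
    pin : (v : V) → T (pinned v) → DVert
    cop : (v : V) → T (not (pinned v)) → Fin m → DVert

  data DArc : DVert → DVert → Set where
    nn : (a : Arc) (sp : T (not (pinned (src a)))) (tp : T (not (pinned (tgt a))))
         (i j : Fin m) → Cong m (toℕ i + label a) (toℕ j) →
         DArc (cop (src a) sp i) (cop (tgt a) tp j)
    pn : (a : Arc) (sp : T (pinned (src a))) (tp : T (not (pinned (tgt a))))
         (i : Fin m) → DArc (pin (src a) sp) (cop (tgt a) tp i)
    np : (a : Arc) (sp : T (not (pinned (src a)))) (tp : T (pinned (tgt a)))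
         (i : Fin m) → DArc (cop (src a) sp i) (pin (tgt a) tp)

  DAdj : DVert → DVert → Set
  DAdj p q = DArc p q ⊎ DArc q p

HasCycle : {W : Set} → (W → W → Set) → ℕ → Set
HasCycle {W} E zero = ⊥
HasCycle {W} E (suc n) =
  3 ≤ suc n ×
  Σ (Fin (suc n) → W) λ f →
    Injective _≡_ _≡_ f ×
    ((i : Fin n) → E (f (inject₁ i)) (f (Fin.suc i))) ×
    E (f (fromℕ n)) (f Fin.zero)

HasGirth : {W : Set} → (W → W → Set) → ℕ → Set
HasGirth E g = HasCycle E g × (∀ k → HasCycle E k → g ≤ k)

zerosPrefix : ℕ → List Bool → Bool
zerosPrefix zero    _           = true
zerosPrefix (suc n) []          = false
zerosPrefix (suc n) (false ∷ b) = zerosPrefix n b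
zerosPrefix (suc n) (true ∷ b)  = false

-- bit strings b that index vertices x_b of X_t:
-- |b| ≤ 2t-1 and x_b is not x_{0^t} or a descendant of it
validBits : ℕ → List Bool → Bool
validBits t b = (length b <ᵇ 2 * t) ∧ not (zerosPrefix t b)

data TVert (t : ℕ) : Set where
  xstar ystar : TVert t
  xv yv : (b : List Bool) → T (validBits t b) → TVert t

data TArc (t : ℕ) : Set where
  xpinArc ypinArc : T (validBits t []) → TArc t
  xchild ychild : (b : List Bool) (c : Bool) →
    T (validBits t b) → T (validBits t (b ++ [ c ])) → TArc t
  bridge : T (validBits t (replicate (t ∸ 1) false)) → TArc t

Tpinned : {t : ℕ} → TVert t → Bool
Tpinned xstar    = true
Tpinned ystar    = true
Tpinned (xv _ _) = false
Tpinned (yv _ _) = false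

Tsrc Ttgt : {t : ℕ} → TArc t → TVert t
Tsrc (xpinArc _)         = xstar
Tsrc (ypinArc _)         = ystar
Tsrc (xchild b c p q)  = xv b p
Tsrc (ychild b c p q)  = yv b p
Tsrc {t} (bridge p)    = xv _ p
Ttgt (xpinArc p)       = xv [] p
Ttgt (ypinArc p)       = yv [] p
Ttgt (xchild b c p q)  = xv (b ++ [ c ]) q
Ttgt (ychild b c p q)  = yv (b ++ [ c ]) q
Ttgt {t} (bridge p)    = yv _ p

T4t+2 : ℕ → VoltageGraph
T4t+2 t = record
  { V = TVert t ; pinned = Tpinned ; Arc = TArc t
  ; src = Tsrc ; tgt = Ttgt ; label = λ _ → 0 }

{-# OPTIONS --safe #-}
-- Let the height of a vertex be its distance from x* in T, so that y* has height 2t + 1,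
-- and lift it to the derived graph. Along every edge the height changes by exactly one,
-- and since all voltages are 0 a non-pinned vertex has only one lower neighbour: its parent,
-- in the same copy. So the highest vertex of a cycle, which has two lower neighbours, is y*;
-- by the symmetry x ↔ y the cycle also passes through x*, and a closed walk through heights
-- 0 and 2t + 1 has length at least 2(2t + 1). Conversely, the x*–y* path of T in copy 0,
-- followed by the same path in copy 1, is a cycle of length 4t + 2.
module Submission where

open import Defs
open import Data.Bool using (Bool; true; false; not; T)
open import Data.Bool.Properties using (T-irrelevant; T-∧; T-not-≡) renaming (_≟_ to _≟ᵇ_)
open import Data.Empty using (⊥; ⊥-elim)
open import Data.Fin using (Fin; toℕ; fromℕ<)
import Data.Fin as Fin
open import Data.Fin.Properties using (toℕ-injective; toℕ-fromℕ; toℕ-fromℕ<; toℕ-inject₁; toℕ<n; toℕ≤pred[n])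
open import Data.List using (List; []; _∷_; _∷ʳ_; [_]; length; replicate; upTo)
open import Data.List.Properties using (length-++; length-replicate; ≡-dec; ∷-injectiveʳ)
open import Data.List.Extrema.Nat using (argmax; argmax-all; f[xs]≤f[argmax])
open import Data.List.Membership.Propositional.Properties using (∈-upTo⁺; ∈-upTo⁻)
import Data.List.Relation.Unary.All as All
open import Data.Nat using (ℕ; zero; suc; _+_; _*_; _∸_; _≤_; _<_; z≤n; s≤s; s≤s⁻¹; ∣_-_∣; _≤?_)
open import Data.Nat.DivMod using (_mod_; m<n⇒m%n≡m)
open import Data.Nat.Properties
open import Data.Nat.Tactic.RingSolver using (solve-∀)
open import Data.Product using (Σ; ∃; ∃₂; _×_; _,_; proj₁; proj₂; map₂)
open import Data.Sum using (_⊎_; inj₁; inj₂; swap)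
open import Data.Unit using (⊤; tt)
open import Function using (_∘_; Equivalence)
open import Relation.Binary.Definitions using (Symmetric)
open import Relation.Binary.PropositionalEquality hiding ([_])
open import Relation.Nullary using (Dec; yes; no)
open import Relation.Nullary.Decidable using (dec-yes; dec-no)

module _ {W : Set} (E : W → W → Set) where

  record IsCycle (n : ℕ) (F : ℕ → W) : Set where
    field
      2≤n       : 2 ≤ n
      edge      : ∀ k → k < n → E (F k) (F (suc k))
      closing   : E (F n) (F 0)
      injective : ∀ {i j} → i ≤ n → j ≤ n → F i ≡ F j → i ≡ j

  IsCycle⇒HasCycle : ∀ {n F} → IsCycle n F → HasCycle E (suc n)
  IsCycle⇒HasCycle {n} {F} c =
    s≤s 2≤n , F ∘ toℕ ,
    (λ e → toℕ-injective (injective (toℕ≤pred[n] _) (toℕ≤pred[n] _) e)) ,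
    (λ i → subst (λ k → E (F k) (F (suc (toℕ i)))) (sym (toℕ-inject₁ i))
                 (edge (toℕ i) (toℕ<n i))) ,
    subst (λ k → E (F k) (F 0)) (sym (toℕ-fromℕ n)) closing
    where open IsCycle c

  HasCycle⇒IsCycle : ∀ {n} → HasCycle E (suc n) → ∃ (IsCycle n)
  HasCycle⇒IsCycle {n} (s≤s 2≤n , f , f-injective , f-edge , f-closing) =
    f ∘ (_mod suc n) , record
      { 2≤n       = 2≤n
      ; edge      = edge
      ; closing   = subst₂ (λ i j → E (f i) (f j)) (sym (mod-≡ _ (toℕ-fromℕ n)))
                           (sym (mod-≡ Fin.zero refl)) f-closing
      ; injective = λ {i} {j} i≤n j≤n e →
          trans (sym (toℕ-mod i≤n)) (trans (cong toℕ (f-injective e)) (toℕ-mod j≤n))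
      }
    where
    toℕ-mod : ∀ {k} → k ≤ n → toℕ (k mod suc n) ≡ k
    toℕ-mod k≤n = trans (toℕ-fromℕ< _) (m<n⇒m%n≡m (s≤s k≤n))

    mod-≡ : ∀ {k} (i : Fin (suc n)) → toℕ i ≡ k → k mod suc n ≡ i
    mod-≡ i refl = toℕ-injective (toℕ-mod (toℕ≤pred[n] i))

    edge : ∀ k → k < n → E (f (k mod suc n)) (f (suc k mod suc n))
    edge k k<n = subst₂ (λ i j → E (f i) (f j))
      (sym (mod-≡ _ (trans (toℕ-inject₁ i) (toℕ-fromℕ< k<n))))
      (sym (mod-≡ (Fin.suc i) (cong suc (toℕ-fromℕ< k<n))))
      (f-edge i)
      where
      i : Fin n
      i = fromℕ< k<n

  cycle-neighbours : Symmetric E → ∀ {n F} → IsCycle n F → ∀ {k} → k ≤ n →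
    ∃₂ λ p q → p ≤ n × q ≤ n × p ≢ q × E (F p) (F k) × E (F q) (F k)
  cycle-neighbours E-sym {n} {F} c = neighbours
    where
    open IsCycle c

    neighbours : ∀ {k} → k ≤ n → ∃₂ λ p q → p ≤ n × q ≤ n × p ≢ q × E (F p) (F k) × E (F q) (F k)
    neighbours {zero} _ = n , 1 , ≤-refl , <⇒≤ 2≤n , >⇒≢ 2≤n , closing , E-sym (edge 0 (<⇒≤ 2≤n))
    neighbours {suc k} k<n with m≤n⇒m<n∨m≡n k<n
    ... | inj₁ 1+k<n = k , suc (suc k) , <⇒≤ k<n , 1+k<n , <⇒≢ (m<n⇒m<1+n (n<1+n k)) ,
                       edge k k<n , E-sym (edge (suc k) 1+k<n)
    ... | inj₂ 1+k≡n = k , 0 , <⇒≤ k<n , z≤n , >⇒≢ (s≤s⁻¹ (subst (2 ≤_) (sym 1+k≡n) 2≤n)) , edge k k<n ,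
                       E-sym (subst (λ j → E (F j) (F 0)) (sym 1+k≡n) closing)

max-attained : (f : ℕ → ℕ) (n : ℕ) → ∃ λ k → k ≤ n × (∀ {j} → j ≤ n → f j ≤ f k)
max-attained f n =
  k , argmax-all f {P = _≤ n} z≤n (All.tabulate (s≤s⁻¹ ∘ ∈-upTo⁻)) ,
  λ j≤n → All.lookup (f[xs]≤f[argmax] {f = f} 0 (upTo (suc n))) (∈-upTo⁺ (s≤s j≤n))
  where
  k : ℕ
  k = argmax f 0 (upTo (suc n))

m<n⇒n∸m≡1+n∸[1+m] : ∀ {m n} → m < n → n ∸ m ≡ suc (n ∸ suc m)
m<n⇒n∸m≡1+n∸[1+m] {n = suc n} m<n = +-∸-assoc 1 (s≤s⁻¹ m<n)

1+m≡n⇒∣m-n∣≡1 : ∀ {m n} → suc m ≡ n → ∣ m - n ∣ ≡ 1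
1+m≡n⇒∣m-n∣≡1 {zero}  refl = refl
1+m≡n⇒∣m-n∣≡1 {suc m} refl = 1+m≡n⇒∣m-n∣≡1 {m} refl

private
  round-trip : ∀ p d₁ d₂ → d₁ + (p + (1 + d₂)) ≡ suc (p + d₁ + d₂)
  round-trip = solve-∀

module _ (g : ℕ → ℕ) {n : ℕ} (step : ∀ k → k < n → ∣ g k - g (suc k) ∣ ≤ 1) where

  walk-bound : ∀ i d → i + d ≤ n → ∣ g i - g (i + d) ∣ ≤ d
  walk-bound i zero _ rewrite +-identityʳ i | ∣n-n∣≡0 (g i) = z≤n
  walk-bound i (suc d) i+d<n rewrite +-suc i d = begin
    ∣ g i - g (suc (i + d)) ∣                                ≤⟨ ∣-∣-triangle (g i) (g (i + d)) _ ⟩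
    ∣ g i - g (i + d) ∣ + ∣ g (i + d) - g (suc (i + d)) ∣   ≤⟨ +-mono-≤ (walk-bound i d (<⇒≤ i+d<n))
                                                                         (step (i + d) i+d<n) ⟩
    d + 1                                                    ≡⟨ +-comm d 1 ⟩
    suc d                                                    ∎
    where open ≤-Reasoning

  closed-walk-bound-≤ : ∣ g n - g 0 ∣ ≤ 1 → ∀ {p q} → p ≤ q → q ≤ n →
                        2 * ∣ g p - g q ∣ ≤ suc n
  closed-walk-bound-≤ wrap {p} p≤q q≤n with m≤n⇒∃[o]m+o≡n p≤q | m≤n⇒∃[o]m+o≡n q≤n
  ... | d₁ , refl | d₂ , q+d₂≡n = begin
    2 * X                ≡⟨ cong (X +_) (+-identityʳ X) ⟩
    X + X                ≤⟨ +-mono-≤ forward backward ⟩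
    d₁ + (p + (1 + d₂))  ≡⟨ round-trip p d₁ d₂ ⟩
    suc (p + d₁ + d₂)    ≡⟨ cong suc q+d₂≡n ⟩
    suc n                ∎
    where
    open ≤-Reasoning
    q X : ℕ
    q = p + d₁
    X = ∣ g p - g q ∣

    forward : X ≤ d₁
    forward = walk-bound p d₁ q≤n

    backward : X ≤ p + (1 + d₂)
    backward = begin
      X                                                   ≤⟨ ∣-∣-triangle (g p) (g 0) (g q) ⟩
      ∣ g p - g 0 ∣ + ∣ g 0 - g q ∣                       ≤⟨ +-monoʳ-≤ _ (∣-∣-triangle (g 0) (g n) (g q)) ⟩
      ∣ g p - g 0 ∣ + (∣ g 0 - g n ∣ + ∣ g n - g q ∣)     ≤⟨ +-mono-≤ p←0 (+-mono-≤ 0←n n←q) ⟩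
      p + (1 + d₂)                                        ∎
      where
      p←0 : ∣ g p - g 0 ∣ ≤ p
      p←0 = subst (_≤ p) (∣-∣-comm (g 0) (g p)) (walk-bound 0 p (≤-trans (m≤m+n p d₁) q≤n))
      0←n : ∣ g 0 - g n ∣ ≤ 1
      0←n = subst (_≤ 1) (∣-∣-comm (g n) (g 0)) wrap
      n←q : ∣ g n - g q ∣ ≤ d₂
      n←q = subst (λ k → ∣ g k - g q ∣ ≤ d₂) q+d₂≡n
              (subst (_≤ d₂) (∣-∣-comm (g q) (g (q + d₂)))
                     (walk-bound q d₂ (≤-reflexive q+d₂≡n)))

  closed-walk-bound : ∣ g n - g 0 ∣ ≤ 1 → ∀ {p q} → p ≤ n → q ≤ n → 2 * ∣ g p - g q ∣ ≤ suc n
  closed-walk-bound wrap {p} {q} p≤n q≤n with ≤-total p q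
  ... | inj₁ p≤q = closed-walk-bound-≤ wrap p≤q q≤n
  ... | inj₂ q≤p rewrite ∣-∣-comm (g p) (g q) = closed-walk-bound-≤ wrap q≤p p≤n

module Graded {W : Set} (E : W → W → Set) (E-sym : Symmetric E) (h : W → ℕ)
               (graded : ∀ {u v} → E u v → ∣ h u - h v ∣ ≡ 1) where

  LowerNeighbour : W → W → Set
  LowerNeighbour u v = E u v × h u < h v

  lower-neighbour : ∀ {u v} → E u v → h u ≤ h v → LowerNeighbour u v
  lower-neighbour e hu≤hv =
    e , ≤∧≢⇒< hu≤hv (λ hu≡hv → 0≢1+n (trans (sym (m≡n⇒∣m-n∣≡0 hu≡hv)) (graded e)))

  cycle-peak : ∀ {n F} → IsCycle E n F →
    ∃ λ k → k ≤ n × ∃₂ λ u w → u ≢ w × LowerNeighbour u (F k) × LowerNeighbour w (F k)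
  cycle-peak {n} {F} c with max-attained (h ∘ F) n
  ... | k , k≤n , maximal with cycle-neighbours E E-sym c k≤n
  ...   | p , q , p≤n , q≤n , p≢q , Ep , Eq =
    k , k≤n , F p , F q , p≢q ∘ IsCycle.injective c p≤n q≤n ,
    lower-neighbour Ep (maximal p≤n) , lower-neighbour Eq (maximal q≤n)

  cycle-length-bound : ∀ {n F} → IsCycle E n F → ∀ {p q} → p ≤ n → q ≤ n →
                       2 * ∣ h (F p) - h (F q) ∣ ≤ suc n
  cycle-length-bound {F = F} c =
    closed-walk-bound (h ∘ F) (λ k k<n → ≤-reflexive (graded (edge k k<n)))
                      (≤-reflexive (graded closing))
    where open IsCycle c

zeros : ℕ → List Bool
zeros k = replicate k false

init : List Bool → List Bool
init []          = []
init (_ ∷ [])    = []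
init (x ∷ y ∷ b) = x ∷ init (y ∷ b)

init-∷ʳ : ∀ b c → init (b ∷ʳ c) ≡ b
init-∷ʳ []          c = refl
init-∷ʳ (x ∷ [])    c = refl
init-∷ʳ (x ∷ y ∷ b) c = cong (x ∷_) (init-∷ʳ (y ∷ b) c)

∷-init-∷ʳ : ∀ x b → ∃ λ c → x ∷ b ≡ init (x ∷ b) ∷ʳ c
∷-init-∷ʳ x []      = x , refl
∷-init-∷ʳ x (y ∷ b) with ∷-init-∷ʳ y b
... | c , e = c , cong (x ∷_) e

length-∷ʳ : ∀ (b : List Bool) c → length (b ∷ʳ c) ≡ suc (length b)
length-∷ʳ b c = trans (length-++ b) (+-comm (length b) 1)

-- Distance from b to zeros k in the complete binary tree of bit strings,
-- and the neighbour of b on the way to zeros k (junk value for b = zeros k).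
dist : ℕ → List Bool → ℕ
dist k       []          = k
dist zero    (_ ∷ b)     = suc (length b)
dist (suc k) (false ∷ b) = dist k b
dist (suc k) (true ∷ b)  = suc (length b) + suc k

toward : ℕ → List Bool → List Bool
toward zero    b           = init b
toward (suc k) []          = [ false ]
toward (suc k) (false ∷ b) = false ∷ toward k b
toward (suc k) (true ∷ b)  = init (true ∷ b)

dist-zero : ∀ b → dist 0 b ≡ length b
dist-zero []      = refl
dist-zero (_ ∷ _) = refl

dist-zeros : ∀ k → dist k (zeros k) ≡ 0
dist-zeros zero    = refl
dist-zeros (suc k) = dist-zeros k

length-init : ∀ x b → suc (length (init (x ∷ b))) ≡ length (x ∷ b)
length-init x b with ∷-init-∷ʳ x b
... | c , e = sym (trans (cong length e) (length-∷ʳ (init (x ∷ b)) c))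

toward-child : ∀ k b c →
  (toward k (b ∷ʳ c) ≡ b × suc (dist k b) ≡ dist k (b ∷ʳ c) × b ∷ʳ c ≢ zeros k) ⊎
  (toward k b ≡ b ∷ʳ c × suc (dist k (b ∷ʳ c)) ≡ dist k b × b ≢ zeros k)
toward-child zero b c =
  inj₁ (init-∷ʳ b c , trans (cong suc (dist-zero b)) (sym (trans (dist-zero (b ∷ʳ c)) (length-∷ʳ b c))) ,
        λ e → 0≢1+n (trans (sym (cong length e)) (length-∷ʳ b c)))
toward-child (suc k) []          false = inj₂ (refl , refl , λ ())
toward-child (suc k) []          true  = inj₁ (refl , refl , λ ())
toward-child (suc k) (false ∷ b) c with toward-child k b c
... | inj₁ (t≡ , d≡ , b≢) = inj₁ (cong (false ∷_) t≡ , d≡ , b≢ ∘ ∷-injectiveʳ)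
... | inj₂ (t≡ , d≡ , b≢) = inj₂ (cong (false ∷_) t≡ , d≡ , b≢ ∘ ∷-injectiveʳ)
toward-child (suc k) (true ∷ b)  c =
  inj₁ (init-∷ʳ (true ∷ b) c , cong (_+ suc k) (sym (cong suc (length-∷ʳ b c))) , λ ())

toward-parent : ∀ k b → b ≢ zeros k → suc (dist k (toward k b)) ≡ dist k b ×
  ((∃ λ c → b ≡ toward k b ∷ʳ c) ⊎ (∃ λ c → toward k b ≡ b ∷ʳ c × length b < k))
toward-parent zero    []          b≢ = ⊥-elim (b≢ refl)
toward-parent zero    (x ∷ b)     _  =
  trans (cong suc (dist-zero (init (x ∷ b)))) (length-init x b) , inj₁ (∷-init-∷ʳ x b)
toward-parent (suc k) []          _  = refl , inj₂ (false , refl , s≤s z≤n)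
toward-parent (suc k) (false ∷ b) b≢ with toward-parent k b (b≢ ∘ cong (false ∷_))
... | d≡ , inj₁ (c , e)          = d≡ , inj₁ (c , cong (false ∷_) e)
... | d≡ , inj₂ (c , e , |b|<k)  = d≡ , inj₂ (c , cong (false ∷_) e , s≤s |b|<k)
toward-parent (suc k) (true ∷ [])    _ = refl , inj₁ (true , refl)
toward-parent (suc k) (true ∷ y ∷ b) _ =
  cong (λ l → suc l + suc k) (length-init y b) , inj₁ (∷-init-∷ʳ true (y ∷ b))

zerosPrefix-short : ∀ k b → length b < k → zerosPrefix k b ≡ false
zerosPrefix-short (suc k) []          _         = refl
zerosPrefix-short (suc k) (false ∷ b) (s≤s |b|<k) = zerosPrefix-short k b |b|<k
zerosPrefix-short (suc k) (true ∷ b)  _         = refl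

zerosPrefix-∷ʳ : ∀ k b c → zerosPrefix k (b ∷ʳ c) ≡ false → zerosPrefix k b ≡ false
zerosPrefix-∷ʳ zero    b           c ()
zerosPrefix-∷ʳ (suc k) []          c _ = refl
zerosPrefix-∷ʳ (suc k) (false ∷ b) c e = zerosPrefix-∷ʳ k b c e
zerosPrefix-∷ʳ (suc k) (true ∷ b)  c _ = refl

Cong-<⇒≡ : ∀ {m x y} → x < m → y < m → Cong m x y → x ≡ y
Cong-<⇒≡ _ _ (zero , inj₁ e) = trans e (+-identityʳ _)
Cong-<⇒≡ _ _ (zero , inj₂ e) = sym (trans e (+-identityʳ _))
Cong-<⇒≡ {m} {y = y} x<m _ (suc k , inj₁ e) =
  ⊥-elim (<⇒≱ x<m (subst (m ≤_) (sym e) (≤-trans (m≤m+n m (k * m)) (m≤n+m _ y))))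
Cong-<⇒≡ {m} {x} _ y<m (suc k , inj₂ e) =
  ⊥-elim (<⇒≱ y<m (subst (m ≤_) (sym e) (≤-trans (m≤m+n m (k * m)) (m≤n+m _ x))))

module _ (G : VoltageGraph) where
  open VoltageGraph G

  Adjacent : V → V → Set
  Adjacent u v = Σ Arc λ a → (src a ≡ u × tgt a ≡ v) ⊎ (src a ≡ v × tgt a ≡ u)

  Adjacent-sym : Symmetric Adjacent
  Adjacent-sym (a , e) = a , swap e

module ZeroVoltage (m : ℕ) (G : VoltageGraph)
  (zero-label : ∀ a → VoltageGraph.label G a ≡ 0)
  (no-pinned-arc : ∀ a → T (VoltageGraph.pinned G (VoltageGraph.src G a)) →
                         T (VoltageGraph.pinned G (VoltageGraph.tgt G a)) → ⊥) where

  open VoltageGraph G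

  base : DVert m G → V
  base (pin v _)   = v
  base (cop v _ _) = v

  -- A pinned vertex lies in every copy.
  SameCopy : DVert m G → DVert m G → Set
  SameCopy (cop _ _ i) (cop _ _ j) = i ≡ j
  SameCopy _           _           = ⊤

  arc-Cong⇒≡ : ∀ a {i j : Fin m} → Cong m (toℕ i + label a) (toℕ j) → i ≡ j
  arc-Cong⇒≡ a {i} {j} =
    toℕ-injective ∘ Cong-<⇒≡ (toℕ<n i) (toℕ<n j) ∘
    subst (λ x → Cong m x (toℕ j)) (trans (cong (toℕ i +_) (zero-label a)) (+-identityʳ _))

  arc-Cong : ∀ a (i : Fin m) → Cong m (toℕ i + label a) (toℕ i)
  arc-Cong a i = 0 , inj₁ (cong (toℕ i +_) (zero-label a))

  DAdj⇒Adjacent : ∀ {u v} → DAdj m G u v → Adjacent G (base u) (base v) × SameCopy u v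
  DAdj⇒Adjacent (inj₁ (nn a _ _ _ _ c)) = (a , inj₁ (refl , refl)) , arc-Cong⇒≡ a c
  DAdj⇒Adjacent (inj₁ (pn a _ _ _))     = (a , inj₁ (refl , refl)) , tt
  DAdj⇒Adjacent (inj₁ (np a _ _ _))     = (a , inj₁ (refl , refl)) , tt
  DAdj⇒Adjacent (inj₂ (nn a _ _ _ _ c)) = (a , inj₂ (refl , refl)) , sym (arc-Cong⇒≡ a c)
  DAdj⇒Adjacent (inj₂ (pn a _ _ _))     = (a , inj₂ (refl , refl)) , tt
  DAdj⇒Adjacent (inj₂ (np a _ _ _))     = (a , inj₂ (refl , refl)) , tt

  Adjacent⇒DAdj : ∀ {u v} → Adjacent G (base u) (base v) → SameCopy u v → DAdj m G u v
  Adjacent⇒DAdj {cop _ px i} {cop _ py _} (a , inj₁ (refl , refl)) refl = inj₁ (nn a px py i i (arc-Cong a i))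
  Adjacent⇒DAdj {cop _ px i} {cop _ py _} (a , inj₂ (refl , refl)) refl = inj₂ (nn a py px i i (arc-Cong a i))
  Adjacent⇒DAdj {pin _ px}   {cop _ py j} (a , inj₁ (refl , refl)) _    = inj₁ (pn a px py j)
  Adjacent⇒DAdj {pin _ px}   {cop _ py j} (a , inj₂ (refl , refl)) _    = inj₂ (np a py px j)
  Adjacent⇒DAdj {cop _ px i} {pin _ py}   (a , inj₁ (refl , refl)) _    = inj₁ (np a px py i)
  Adjacent⇒DAdj {cop _ px i} {pin _ py}   (a , inj₂ (refl , refl)) _    = inj₂ (pn a py px i)
  Adjacent⇒DAdj {pin _ px}   {pin _ py}   (a , inj₁ (refl , refl)) _    = ⊥-elim (no-pinned-arc a px py)
  Adjacent⇒DAdj {pin _ px}   {pin _ py}   (a , inj₂ (refl , refl)) _    = ⊥-elim (no-pinned-arc a py px)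

  same-fibre : ∀ {u w y py j} → base u ≡ base w →
               SameCopy u (cop y py j) → SameCopy w (cop y py j) → u ≡ w
  same-fibre {pin x px}   {pin _ px′}    refl _ _ = cong (pin x) (T-irrelevant px px′)
  same-fibre {cop x px i} {cop _ px′ _}  refl refl refl = cong (λ p → cop x p i) (T-irrelevant px px′)
  same-fibre {pin x px}   {cop _ px′ _}  refl _ _ = ⊥-elim (subst T (Equivalence.to T-not-≡ px′) px)
  same-fibre {cop x px _} {pin _ px′}    refl _ _ = ⊥-elim (subst T (Equivalence.to T-not-≡ px) px′)

module Tree (s : ℕ) where

  t : ℕ
  t = suc s

  Vertex : Set
  Vertex = TVert t

  Valid : List Bool → Set
  Valid b = T (validBits t b)

  _~ᵀ_ : Vertex → Vertex → Set
  _~ᵀ_ = Adjacent (T4t+2 t)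

  ~ᵀ-sym : Symmetric _~ᵀ_
  ~ᵀ-sym = Adjacent-sym (T4t+2 t)

  valid⁺ : ∀ b → length b < 2 * t → zerosPrefix t b ≡ false → Valid b
  valid⁺ _ |b|<2t zp = Equivalence.from T-∧ (<⇒<ᵇ |b|<2t , Equivalence.from T-not-≡ zp)

  valid⁻ : ∀ b → Valid b → length b < 2 * t × zerosPrefix t b ≡ false
  valid⁻ b p with Equivalence.to T-∧ p
  ... | |b|<2t , zp = <ᵇ⇒< (length b) (2 * t) |b|<2t , Equivalence.to T-not-≡ zp

  valid-short : ∀ b → length b < t → Valid b
  valid-short b |b|<t = valid⁺ b (≤-trans |b|<t (m≤m+n t _)) (zerosPrefix-short t b |b|<t)

  valid-∷ʳ⁻ : ∀ b c → Valid (b ∷ʳ c) → Valid b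
  valid-∷ʳ⁻ b c p with valid⁻ (b ∷ʳ c) p
  ... | |bc|<2t , zp =
    valid⁺ b (<-trans (subst (length b <_) (sym (length-∷ʳ b c)) ≤-refl) |bc|<2t) (zerosPrefix-∷ʳ t b c zp)

  valid-toward : ∀ {k b} → k < t → Valid b → b ≢ zeros k → Valid (toward k b)
  valid-toward {k} {b} k<t p b≢ with toward-parent k b b≢
  ... | _ , inj₁ (c , b≡) = valid-∷ʳ⁻ (toward k b) c (subst Valid b≡ p)
  ... | _ , inj₂ (c , t≡ , |b|<k) =
    valid-short (toward k b) (subst (_< t) (sym (trans (cong length t≡) (length-∷ʳ b c))) (≤-trans (s≤s |b|<k) k<t))

  xv-≡ : ∀ {b b′} {p : Valid b} {q : Valid b′} → b ≡ b′ → _≡_ {A = Vertex} (xv b p) (xv b′ q)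
  xv-≡ {p = p} {q} refl = cong (xv _) (T-irrelevant p q)

  yv-≡ : ∀ {b b′} {p : Valid b} {q : Valid b′} → b ≡ b′ → _≡_ {A = Vertex} (yv b p) (yv b′ q)
  yv-≡ {p = p} {q} refl = cong (yv _) (T-irrelevant p q)

  height : Vertex → ℕ
  height xstar    = 0
  height (xv b _) = suc (dist 0 b)
  height (yv b _) = suc (dist s b + t)
  height ystar    = suc (t + t)

  -- The neighbour on the way to the root x* (junk value for x* itself).
  parent : Vertex → Vertex
  parent xstar    = xstar
  parent (xv b p) with ≡-dec _≟ᵇ_ b []
  ... | yes _  = xstar
  ... | no b≢ = xv (toward 0 b) (valid-toward (s≤s z≤n) p b≢)
  parent (yv b p) with ≡-dec _≟ᵇ_ b (zeros s)
  ... | yes _  = xv b p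
  ... | no b≢ = yv (toward s b) (valid-toward ≤-refl p b≢)
  parent ystar    = yv [] (valid-short [] (s≤s z≤n))

  parent-xv : ∀ {b b′} {p : Valid b} {q : Valid b′} → b ≢ [] → toward 0 b ≡ b′ → parent (xv b p) ≡ xv b′ q
  parent-xv {b} b≢ t≡ with ≡-dec _≟ᵇ_ b []
  ... | yes b≡ = ⊥-elim (b≢ b≡)
  ... | no _   = xv-≡ t≡

  parent-yv : ∀ {b b′} {p : Valid b} {q : Valid b′} → b ≢ zeros s → toward s b ≡ b′ → parent (yv b p) ≡ yv b′ q
  parent-yv {b} b≢ t≡ with ≡-dec _≟ᵇ_ b (zeros s)
  ... | yes b≡ = ⊥-elim (b≢ b≡)
  ... | no _   = yv-≡ t≡

  parent-yv-root : ∀ {p : Valid (zeros s)} → parent (yv (zeros s) p) ≡ xv (zeros s) p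
  parent-yv-root with ≡-dec _≟ᵇ_ (zeros s) (zeros s)
  ... | yes _ = refl
  ... | no ≢  = ⊥-elim (≢ refl)

  bridge-height : suc (suc (dist 0 (zeros s))) ≡ suc (dist s (zeros s) + t)
  bridge-height = trans (cong (suc ∘ suc) (trans (dist-zero (zeros s)) (length-replicate s)))
                        (cong (λ d → suc (d + t)) (sym (dist-zeros s)))

  _IsParentOf_ : Vertex → Vertex → Set
  u IsParentOf v = u ≡ parent v × suc (height u) ≡ height v

  arc-parent : ∀ a → Tsrc a IsParentOf Ttgt a ⊎ Ttgt a IsParentOf Tsrc a
  arc-parent (xpinArc _) = inj₁ (refl , refl)
  arc-parent (ypinArc _) = inj₂ (yv-≡ refl , refl)
  arc-parent (xchild b c _ _) with toward-child 0 b c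
  ... | inj₁ (t≡ , d≡ , b≢) = inj₁ (sym (parent-xv b≢ t≡) , cong suc d≡)
  ... | inj₂ (t≡ , d≡ , b≢) = inj₂ (sym (parent-xv b≢ t≡) , cong suc d≡)
  arc-parent (ychild b c _ _) with toward-child s b c
  ... | inj₁ (t≡ , d≡ , b≢) = inj₁ (sym (parent-yv b≢ t≡) , cong (λ d → suc (d + t)) d≡)
  ... | inj₂ (t≡ , d≡ , b≢) = inj₂ (sym (parent-yv b≢ t≡) , cong (λ d → suc (d + t)) d≡)
  arc-parent (bridge _) = inj₁ (sym parent-yv-root , bridge-height)

  ~ᵀ-height : ∀ {u v} → u ~ᵀ v → ∣ height u - height v ∣ ≡ 1
  ~ᵀ-height (a , inj₁ (refl , refl)) with arc-parent a
  ... | inj₁ (_ , e) = 1+m≡n⇒∣m-n∣≡1 e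
  ... | inj₂ (_ , e) = trans (∣-∣-comm (height (Tsrc a)) _) (1+m≡n⇒∣m-n∣≡1 e)
  ~ᵀ-height (a , inj₂ (refl , refl)) with arc-parent a
  ... | inj₁ (_ , e) = trans (∣-∣-comm (height (Ttgt a)) _) (1+m≡n⇒∣m-n∣≡1 e)
  ... | inj₂ (_ , e) = 1+m≡n⇒∣m-n∣≡1 e

  lower-neighbour-is-parent : ∀ {u v} → u ~ᵀ v → height u < height v → u ≡ parent v
  lower-neighbour-is-parent (a , inj₁ (refl , refl)) u<v with arc-parent a
  ... | inj₁ (u≡ , _) = u≡
  ... | inj₂ (_ , e)  = ⊥-elim (<-asym u<v (≤-reflexive e))
  lower-neighbour-is-parent (a , inj₂ (refl , refl)) u<v with arc-parent a
  ... | inj₁ (_ , e)  = ⊥-elim (<-asym u<v (≤-reflexive e))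
  ... | inj₂ (u≡ , _) = u≡

  xchild-~ᵀ : ∀ {b b′ c} {p : Valid b} {q : Valid b′} → b′ ≡ b ∷ʳ c → xv b p ~ᵀ xv b′ q
  xchild-~ᵀ {b} {c = c} {p} {q} refl = xchild b c p q , inj₁ (refl , refl)

  ychild-~ᵀ : ∀ {b b′ c} {p : Valid b} {q : Valid b′} → b′ ≡ b ∷ʳ c → yv b p ~ᵀ yv b′ q
  ychild-~ᵀ {b} {c = c} {p} {q} refl = ychild b c p q , inj₁ (refl , refl)

  parent-~ᵀ : ∀ v → 0 < height v → parent v ~ᵀ v × suc (height (parent v)) ≡ height v
  parent-~ᵀ (xv b p) _ with ≡-dec _≟ᵇ_ b []
  ... | yes refl = (xpinArc p , inj₁ (refl , refl)) , refl
  ... | no b≢ with toward-parent 0 b b≢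
  ...   | d≡ , inj₁ (_ , b≡)     = xchild-~ᵀ b≡ , cong suc d≡
  ...   | d≡ , inj₂ (_ , t≡ , _) = ~ᵀ-sym (xchild-~ᵀ t≡) , cong suc d≡
  parent-~ᵀ (yv b p) _ with ≡-dec _≟ᵇ_ b (zeros s)
  ... | yes refl = (bridge p , inj₁ (refl , refl)) , bridge-height
  ... | no b≢ with toward-parent s b b≢
  ...   | d≡ , inj₁ (_ , b≡)     = ychild-~ᵀ b≡ , cong (λ d → suc (d + t)) d≡
  ...   | d≡ , inj₂ (_ , t≡ , _) = ~ᵀ-sym (ychild-~ᵀ t≡) , cong (λ d → suc (d + t)) d≡
  parent-~ᵀ ystar _ = (ypinArc _ , inj₂ (refl , refl)) , refl

  height≡0⇒xstar : ∀ {v} → height v ≡ 0 → v ≡ xstar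
  height≡0⇒xstar {xstar} _ = refl

  no-pinned-arc : ∀ (a : TArc t) → T (Tpinned (Tsrc a)) → T (Tpinned (Ttgt a)) → ⊥
  no-pinned-arc (xpinArc _)      _ ()
  no-pinned-arc (ypinArc _)      _ ()
  no-pinned-arc (xchild _ _ _ _) ()
  no-pinned-arc (ychild _ _ _ _) ()
  no-pinned-arc (bridge _)       ()

  mirror : Vertex → Vertex
  mirror xstar    = ystar
  mirror ystar    = xstar
  mirror (xv b p) = yv b p
  mirror (yv b p) = xv b p

  mirror-involutive : ∀ v → mirror (mirror v) ≡ v
  mirror-involutive xstar    = refl
  mirror-involutive ystar    = refl
  mirror-involutive (xv _ _) = refl
  mirror-involutive (yv _ _) = refl

  mirror-arc : ∀ (a : TArc t) → mirror (Tsrc a) ~ᵀ mirror (Ttgt a)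
  mirror-arc (xpinArc p)      = ypinArc p , inj₁ (refl , refl)
  mirror-arc (ypinArc p)      = xpinArc p , inj₁ (refl , refl)
  mirror-arc (xchild b c p q) = ychild b c p q , inj₁ (refl , refl)
  mirror-arc (ychild b c p q) = xchild b c p q , inj₁ (refl , refl)
  mirror-arc (bridge p)       = bridge p , inj₂ (refl , refl)

  mirror-~ᵀ : ∀ {u v} → u ~ᵀ v → mirror u ~ᵀ mirror v
  mirror-~ᵀ (a , inj₁ (refl , refl)) = mirror-arc a
  mirror-~ᵀ (a , inj₂ (refl , refl)) = ~ᵀ-sym (mirror-arc a)

  D : ℕ
  D = height ystar

  descent : ℕ → Vertex
  descent zero    = ystar
  descent (suc k) = parent (descent k)

  height-descent : ∀ {k} → k ≤ D → height (descent k) ≡ D ∸ k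
  descent-positive : ∀ {k} → k < D → 0 < height (descent k)

  height-descent {zero}  _   = refl
  height-descent {suc k} k<D = suc-injective (begin
    suc (height (parent (descent k))) ≡⟨ proj₂ (parent-~ᵀ (descent k) (descent-positive k<D)) ⟩
    height (descent k)                ≡⟨ height-descent (<⇒≤ k<D) ⟩
    D ∸ k                             ≡⟨ m<n⇒n∸m≡1+n∸[1+m] k<D ⟩
    suc (D ∸ suc k)                   ∎)
    where open ≡-Reasoning

  descent-positive k<D = subst (0 <_) (sym (height-descent (<⇒≤ k<D))) (m<n⇒0<n∸m k<D)

  descent-~ᵀ : ∀ {k} → k < D → descent (suc k) ~ᵀ descent k
  descent-~ᵀ {k} k<D = proj₁ (parent-~ᵀ (descent k) (descent-positive k<D))

  descent-bottom : descent D ≡ xstar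
  descent-bottom = height≡0⇒xstar (trans (height-descent ≤-refl) (n∸n≡0 D))

module Derived (s m : ℕ) where
  open Tree s

  open ZeroVoltage m (T4t+2 t) (λ _ → refl) no-pinned-arc

  DVertex : Set
  DVertex = DVert m (T4t+2 t)

  _~_ : DVertex → DVertex → Set
  _~_ = DAdj m (T4t+2 t)

  ~-sym : Symmetric _~_
  ~-sym = swap

  h : DVertex → ℕ
  h = height ∘ base

  ~-height : ∀ {u v} → u ~ v → ∣ h u - h v ∣ ≡ 1
  ~-height = ~ᵀ-height ∘ proj₁ ∘ DAdj⇒Adjacent

  open Graded _~_ ~-sym h ~-height

  two-lower-neighbours⇒ystar : ∀ {u w v} → u ≢ w →
    LowerNeighbour u v → LowerNeighbour w v → base v ≡ ystar
  two-lower-neighbours⇒ystar {v = pin xstar _}    _ (_ , ()) _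
  two-lower-neighbours⇒ystar {v = pin ystar _}    _ _ _ = refl
  two-lower-neighbours⇒ystar {v = pin (xv _ _) ()}
  two-lower-neighbours⇒ystar {v = pin (yv _ _) ()}
  two-lower-neighbours⇒ystar {u} {w} {cop _ _ _} u≢w (u~v , u<v) (w~v , w<v)
    with DAdj⇒Adjacent u~v | DAdj⇒Adjacent w~v
  ... | u~ᵀv , u-copy | w~ᵀv , w-copy = ⊥-elim (u≢w (same-fibre same-base u-copy w-copy))
    where
    same-base : base u ≡ base w
    same-base = trans (lower-neighbour-is-parent u~ᵀv u<v) (sym (lower-neighbour-is-parent w~ᵀv w<v))

  mirrorᴰ : DVertex → DVertex
  mirrorᴰ (pin xstar _)      = pin ystar tt
  mirrorᴰ (pin ystar _)      = pin xstar tt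
  mirrorᴰ (cop (xv b p) _ i) = cop (yv b p) tt i
  mirrorᴰ (cop (yv b p) _ i) = cop (xv b p) tt i

  base-mirrorᴰ : ∀ u → base (mirrorᴰ u) ≡ mirror (base u)
  base-mirrorᴰ (pin xstar _)      = refl
  base-mirrorᴰ (pin ystar _)      = refl
  base-mirrorᴰ (cop (xv _ _) _ _) = refl
  base-mirrorᴰ (cop (yv _ _) _ _) = refl

  mirrorᴰ-involutive : ∀ u → mirrorᴰ (mirrorᴰ u) ≡ u
  mirrorᴰ-involutive (pin xstar _)      = refl
  mirrorᴰ-involutive (pin ystar _)      = refl
  mirrorᴰ-involutive (cop (xv _ _) _ _) = refl
  mirrorᴰ-involutive (cop (yv _ _) _ _) = refl

  cop-SameCopy-mirrorᴰ : ∀ {x p y q i} v → SameCopy (cop x p i) v → SameCopy (cop y q i) (mirrorᴰ v)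
  cop-SameCopy-mirrorᴰ (pin xstar _)      _   = tt
  cop-SameCopy-mirrorᴰ (pin ystar _)      _   = tt
  cop-SameCopy-mirrorᴰ (cop (xv _ _) _ _) i≡j = i≡j
  cop-SameCopy-mirrorᴰ (cop (yv _ _) _ _) i≡j = i≡j

  mirrorᴰ-SameCopy : ∀ {u v} → SameCopy u v → SameCopy (mirrorᴰ u) (mirrorᴰ v)
  mirrorᴰ-SameCopy {pin xstar _}      _ = tt
  mirrorᴰ-SameCopy {pin ystar _}      _ = tt
  mirrorᴰ-SameCopy {cop (xv _ _) _ _} {v} = cop-SameCopy-mirrorᴰ v
  mirrorᴰ-SameCopy {cop (yv _ _) _ _} {v} = cop-SameCopy-mirrorᴰ v

  mirrorᴰ-~ : ∀ {u v} → u ~ v → mirrorᴰ u ~ mirrorᴰ v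
  mirrorᴰ-~ {u} {v} u~v with DAdj⇒Adjacent u~v
  ... | u~ᵀv , same-copy =
    Adjacent⇒DAdj (subst₂ _~ᵀ_ (sym (base-mirrorᴰ u)) (sym (base-mirrorᴰ v)) (mirror-~ᵀ u~ᵀv))
                  (mirrorᴰ-SameCopy same-copy)

  mirror-cycle : ∀ {n F} → IsCycle _~_ n F → IsCycle _~_ n (mirrorᴰ ∘ F)
  mirror-cycle {F = F} c = record
    { 2≤n       = 2≤n
    ; edge      = λ k k<n → mirrorᴰ-~ (edge k k<n)
    ; closing   = mirrorᴰ-~ closing
    ; injective = λ i≤n j≤n e → injective i≤n j≤n
        (trans (sym (mirrorᴰ-involutive (F _))) (trans (cong mirrorᴰ e) (mirrorᴰ-involutive (F _))))
    }
    where open IsCycle c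

  cycle-through-ystar : ∀ {n F} → IsCycle _~_ n F → ∃ λ k → k ≤ n × base (F k) ≡ ystar
  cycle-through-ystar c = map₂ (map₂ λ (_ , _ , u≢w , u-lower , w-lower) →
                                 two-lower-neighbours⇒ystar u≢w u-lower w-lower)
                               (cycle-peak c)

  cycle-through-xstar : ∀ {n F} → IsCycle _~_ n F → ∃ λ k → k ≤ n × base (F k) ≡ xstar
  cycle-through-xstar {F = F} c = map₂ (map₂ λ e →
      trans (sym (mirror-involutive _)) (cong mirror (trans (sym (base-mirrorᴰ (F _))) e)))
    (cycle-through-ystar (mirror-cycle c))

  girth-lower-bound : ∀ k → HasCycle _~_ k → 2 * D ≤ k
  girth-lower-bound (suc n) hc =
    let F , c            = HasCycle⇒IsCycle _~_ hc
        p , p≤n , Fp≡x* = cycle-through-xstar c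
        q , q≤n , Fq≡y* = cycle-through-ystar c
    in subst (λ d → 2 * d ≤ suc n) (cong₂ (λ x y → ∣ height x - height y ∣) Fp≡x* Fq≡y*)
             (cycle-length-bound c p≤n q≤n)

module GirthCycle (s m′ : ℕ) where
  open Tree s

  m : ℕ
  m = suc (suc m′)

  open Derived s m
  open ZeroVoltage m (T4t+2 t) (λ _ → refl) no-pinned-arc

  lift : Fin m → Vertex → DVertex
  lift _ xstar    = pin xstar tt
  lift _ ystar    = pin ystar tt
  lift i (xv b p) = cop (xv b p) tt i
  lift i (yv b p) = cop (yv b p) tt i

  base-lift : ∀ i v → base (lift i v) ≡ v
  base-lift _ xstar    = refl
  base-lift _ ystar    = refl
  base-lift _ (xv _ _) = refl
  base-lift _ (yv _ _) = refl

  cop-SameCopy-lift : ∀ {x p} i v → SameCopy (cop x p i) (lift i v)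
  cop-SameCopy-lift _ xstar    = tt
  cop-SameCopy-lift _ ystar    = tt
  cop-SameCopy-lift _ (xv _ _) = refl
  cop-SameCopy-lift _ (yv _ _) = refl

  lift-SameCopy : ∀ i u v → SameCopy (lift i u) (lift i v)
  lift-SameCopy _ xstar    _ = tt
  lift-SameCopy _ ystar    _ = tt
  lift-SameCopy i (xv _ _) v = cop-SameCopy-lift i v
  lift-SameCopy i (yv _ _) v = cop-SameCopy-lift i v

  lift-~ : ∀ i {u v} → u ~ᵀ v → lift i u ~ lift i v
  lift-~ i {u} {v} u~ᵀv =
    Adjacent⇒DAdj (subst₂ _~ᵀ_ (sym (base-lift i u)) (sym (base-lift i v)) u~ᵀv) (lift-SameCopy i u v)

  c₀ c₁ : Fin m
  c₀ = Fin.zero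
  c₁ = Fin.suc Fin.zero

  -- Down from y* to x* in copy c₀ (positions 0 … D), then back up to y* in copy c₁.
  on-half : ∀ k → Dec (k ≤ D) → DVertex
  on-half k (yes _) = lift c₀ (descent k)
  on-half k (no _)  = lift c₁ (descent (D ∸ (k ∸ D)))

  girth-cycle : ℕ → DVertex
  girth-cycle k = on-half k (k ≤? D)

  n₀ : ℕ
  n₀ = D + (t + t)

  cycle-low : ∀ {k} → k ≤ D → girth-cycle k ≡ lift c₀ (descent k)
  cycle-low {k} k≤D = cong (on-half k) (proj₂ (dec-yes (k ≤? D) k≤D))

  cycle-high : ∀ {d} → d ≤ D → girth-cycle (D + d) ≡ lift c₁ (descent (D ∸ d))
  cycle-high {zero} _ = begin
    girth-cycle (D + 0)        ≡⟨ cycle-low (≤-reflexive (+-identityʳ D)) ⟩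
    lift c₀ (descent (D + 0))  ≡⟨ cong (lift c₀ ∘ descent) (+-identityʳ D) ⟩
    lift c₀ (descent D)        ≡⟨ cong (lift c₀) descent-bottom ⟩
    pin xstar tt               ≡⟨ cong (lift c₁) descent-bottom ⟨
    lift c₁ (descent D)        ∎
    where open ≡-Reasoning
  cycle-high {suc d} _ =
    trans (cong (on-half (D + suc d)) (dec-no (D + suc d ≤? D) (<⇒≱ (m<m+n D (s≤s z≤n)))))
          (cong (lift c₁ ∘ descent ∘ (D ∸_)) (m+n∸m≡n D (suc d)))

  cycle-edge-high : ∀ {d} → D + suc d ≤ n₀ → girth-cycle (D + d) ~ girth-cycle (D + suc d)
  cycle-edge-high {d} D+1+d≤n₀ =
    subst₂ _~_ (sym (cycle-high (<⇒≤ d<D))) (sym (cycle-high d<D)) (lift-~ c₁ step-up)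
    where
    d<D : d < D
    d<D = ≤-trans (+-cancelˡ-≤ D (suc d) (t + t) D+1+d≤n₀) (n≤1+n (t + t))
    step-up : descent (D ∸ d) ~ᵀ descent (D ∸ suc d)
    step-up = subst (λ j → descent j ~ᵀ descent (D ∸ suc d)) (sym (m<n⇒n∸m≡1+n∸[1+m] d<D))
                    (descent-~ᵀ (∸-monoʳ-< (s≤s z≤n) d<D))

  cycle-edge : ∀ k → k < n₀ → girth-cycle k ~ girth-cycle (suc k)
  cycle-edge k k<n₀ with ≤-<-connex (suc k) D
  ... | inj₁ k<D = subst₂ _~_ (sym (cycle-low (<⇒≤ k<D))) (sym (cycle-low k<D))
                         (~-sym (lift-~ c₀ (descent-~ᵀ k<D)))
  ... | inj₂ D<1+k with m≤n⇒∃[o]m+o≡n (s≤s⁻¹ D<1+k)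
  ...   | d , refl = subst (λ j → girth-cycle (D + d) ~ girth-cycle j) (+-suc D d)
                           (cycle-edge-high (subst (_≤ n₀) (sym (+-suc D d)) k<n₀))

  cycle-closing : girth-cycle n₀ ~ girth-cycle 0
  cycle-closing =
    subst₂ _~_ (sym (trans (cycle-high (n≤1+n (t + t))) (cong (lift c₁ ∘ descent) (m+n∸n≡m 1 (t + t)))))
               (sym (cycle-low z≤n))
               (lift-~ c₁ (descent-~ᵀ (s≤s z≤n)))

  -- A left inverse of girth-cycle on 0 … n₀.
  position : DVertex → ℕ
  position (pin v _)            = D ∸ height v
  position (cop v _ Fin.zero)    = D ∸ height v
  position (cop v _ (Fin.suc _)) = D + height v

  position-lift₀ : ∀ v → position (lift c₀ v) ≡ D ∸ height v
  position-lift₀ xstar    = refl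
  position-lift₀ ystar    = refl
  position-lift₀ (xv _ _) = refl
  position-lift₀ (yv _ _) = refl

  position-lift₁ : ∀ v → height v < D → position (lift c₁ v) ≡ D + height v
  position-lift₁ xstar    _   = sym (+-identityʳ D)
  position-lift₁ ystar    D<D = ⊥-elim (<-irrefl refl D<D)
  position-lift₁ (xv _ _) _   = refl
  position-lift₁ (yv _ _) _   = refl

  position-low : ∀ {k} → k ≤ D → position (girth-cycle k) ≡ k
  position-low {k} k≤D = begin
    position (girth-cycle k)       ≡⟨ cong position (cycle-low k≤D) ⟩
    position (lift c₀ (descent k)) ≡⟨ position-lift₀ (descent k) ⟩
    D ∸ height (descent k)         ≡⟨ cong (D ∸_) (height-descent k≤D) ⟩
    D ∸ (D ∸ k)                    ≡⟨ m∸[m∸n]≡n k≤D ⟩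
    k                              ∎
    where open ≡-Reasoning

  position-high : ∀ {d} → d ≤ t + t → position (girth-cycle (D + d)) ≡ D + d
  position-high {d} d≤2t = begin
    position (girth-cycle (D + d))             ≡⟨ cong position (cycle-high d≤D) ⟩
    position (lift c₁ (descent (D ∸ d)))       ≡⟨ position-lift₁ _ (subst (_< D) (sym height≡d) (s≤s d≤2t)) ⟩
    D + height (descent (D ∸ d))               ≡⟨ cong (D +_) height≡d ⟩
    D + d                                      ∎
    where
    open ≡-Reasoning
    d≤D : d ≤ D
    d≤D = ≤-trans d≤2t (n≤1+n (t + t))
    height≡d : height (descent (D ∸ d)) ≡ d
    height≡d = trans (height-descent (m∸n≤m D d)) (m∸[m∸n]≡n d≤D)

  position-cycle : ∀ {k} → k ≤ n₀ → position (girth-cycle k) ≡ k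
  position-cycle {k} k≤n₀ with ≤-total k D
  ... | inj₁ k≤D = position-low k≤D
  ... | inj₂ D≤k with m≤n⇒∃[o]m+o≡n D≤k
  ...   | d , refl = position-high (+-cancelˡ-≤ D d (t + t) k≤n₀)

  girth-cycle-IsCycle : IsCycle _~_ n₀ girth-cycle
  girth-cycle-IsCycle = record
    { 2≤n       = ≤-trans (s≤s (s≤s z≤n)) (m≤m+n D (t + t))
    ; edge      = cycle-edge
    ; closing   = cycle-closing
    ; injective = λ i≤n₀ j≤n₀ e →
        trans (sym (position-cycle i≤n₀)) (trans (cong position e) (position-cycle j≤n₀))
    }

private
  length-identity : ∀ t → suc (suc (t + t) + (t + t)) ≡ 4 * t + 2
  length-identity = solve-∀

  girth-identity : ∀ t → 2 * suc (t + t) ≡ 4 * t + 2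
  girth-identity = solve-∀

lemma4 : (t m : ℕ) → 1 ≤ t → 2 ≤ m →
    HasGirth (DAdj m (T4t+2 t)) (4 * t + 2)
lemma4 (suc _) (suc zero)       _ (s≤s ())
lemma4 (suc s) (suc (suc m′)) _ _ =
  subst (HasCycle _~_) (length-identity (suc s)) (IsCycle⇒HasCycle _~_ girth-cycle-IsCycle) ,
  λ k cycle → subst (_≤ k) (girth-identity (suc s)) (girth-lower-bound k cycle)
  where
  open Derived s (suc (suc m′))
  open GirthCycle s m′
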